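{- Let $R$ be a reference string whose last character is the sentinel $\#$, and let ${\cal C}$ be a string collection, viewed as the concatenation of its strings, each terminated by an end-of-string character. Let $\textit{SA}_R$ be the suffix array of $R$, and for each position $i$ of ${\cal C}$ let $\textit{ip}(i)$ be the insert point of $i$ (defined in the context). Let $i,j$ be positions of ${\cal C}$ such that $\textit{ip}(i)=\textit{ip}(j)$ and neither $i$ nor $j$ is an insert-head. Then the suffixes of ${\cal C}$ starting at $i$ and $j$ are preceded by the same character, namely ${\cal C}[i-1]={\cal C}[j-1]=R[\textit{SA}_R[\textit{ip}(i)]-1]$.
   Context: Strings are 1-indexed; $T[i..j]$ denotes a substring, $\textit{suf}_i(T)=T[i..|T|]$. The suffix array $\textit{SA}_R$ of $R$ is the permutation of $\{1,\dots,|R|\}$ with $\textit{SA}_R[k]=p$ iff $\textit{suf}_p(R)$ is the $k$-th smallest suffix of $R$ in lexicographic order. The sentinel $\#$ of $R$ is smaller than every other character, including the end-of-string characters of ${\cal C}$; it is assumed that every character occurring in ${\cal C}$ other than its end-of-string characters also occurs in $R$. For a position $i$ of ${\cal C}$, the matching factor $U_i$ is the longest prefix of $\textit{suf}_i({\cal C})$ that occurs as a substring of $R$, $\ell_i=|U_i|$, and $c=c_i={\cal C}[i+\ell_i]$ is the mismatch character. The insert point is $\textit{ip}(i)=1$ if $U_i=\epsilon$; otherwise $\textit{ip}(i)=\max\{k : U_i \text{ is a prefix of } R[\textit{SA}_R[k]..] \text{ and } R[\textit{SA}_R[k]..]<U_ic\}$ if this set is non-empty; and otherwise $\textit{ip}(i)=\min\{k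 : U_i \text{ is a prefix of } R[\textit{SA}_R[k]..]\}$. A position $j$ of ${\cal C}$ is an insert-head if $\textit{SA}_R[\textit{ip}(j)]\neq \textit{SA}_R[\textit{ip}(j-1)]+1$ (position $1$ is an insert-head). -}

module Defs where

open import Data.Nat using (ℕ; zero; suc; _+_; _∸_; _<_; _≤_; _≟_; _<?_)
open import Data.Nat.Properties using ()
open import Data.Bool using (Bool; true; false; if_then_else_; _∧_)
open import Data.List using (List; []; _∷_; _++_; [_]; drop; take; length; map; filter; head; last; upTo; concatMap)
open import Data.List.Relation.Unary.Any using (Any)
open import Data.List.Relation.Unary.All using (All)
open import Data.List.Membership.Propositional using (_∈_)
open import Data.Maybe using (Maybe; just; nothing; fromMaybe)
open import Data.Product using (_×_; _,_; proj₁; proj₂)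
open import Relation.Nullary using (¬_; Dec; yes; no)
open import Relation.Nullary.Decidable using (⌊_⌋; _×-dec_)
open import Relation.Binary.PropositionalEquality using (_≡_; _≢_)
open import Data.List.Relation.Binary.Lex.Strict using (Lex-<; <-decidable)
open import Data.List.Relation.Binary.Infix.Heterogeneous using (Infix)
open import Data.List.Relation.Binary.Infix.Heterogeneous.Properties using (infix?)
open import Data.List.Relation.Binary.Prefix.Heterogeneous using (Prefix)
open import Data.List.Relation.Binary.Prefix.Heterogeneous.Properties using (prefix?)

-- Strings are lists of characters; characters are natural numbers with
-- the usual order.  The sentinel # is the character 0 (smallest of all).
Str : Set
Str = List ℕ

sentinel : ℕ
sentinel = 0

-- 1-indexed character access T[i]; out of range gives the default 0
-- (never used at in-range positions).
charAt : Str → ℕ → ℕ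
charAt T i = fromMaybe 0 (head (drop (i ∸ 1) T))

suf : ℕ → Str → Str
suf i T = drop (i ∸ 1) T

_<ˡ_ : Str → Str → Set
_<ˡ_ = Lex-< _≡_ _<_

_<ˡ?_ : (u v : Str) → Dec (u <ˡ v)
_<ˡ?_ = <-decidable _≟_ _<?_

OccursIn : Str → Str → Set
OccursIn u T = Infix _≡_ u T

IsPrefix : Str → Str → Set
IsPrefix u v = Prefix _≡_ u v

-- SA is the suffix array of R: on positions 1..|R| it takes values in
-- 1..|R| and lists the suffixes of R in strictly increasing lexicographic
-- order (this determines SA uniquely on 1..|R| and forces it to be a
-- permutation of {1,..,|R|}).
IsSuffixArray : Str → (ℕ → ℕ) → Set
IsSuffixArray R SA =
  (∀ k → 1 ≤ k → k ≤ length R → 1 ≤ SA k × SA k ≤ length R) ×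
  (∀ k k' → 1 ≤ k → k < k' → k' ≤ length R →
     suf (SA k) R <ˡ suf (SA k') R)

ranks : ℕ → List ℕ
ranks n = map suc (upTo n)

-- ℓ_i: length of the longest prefix of u that occurs in R
-- (search downwards over candidate lengths; occurrence is prefix-closed)
matchLenFrom : ℕ → Str → Str → ℕ
matchLenFrom zero    u R = zero
matchLenFrom (suc m) u R with infix? _≟_ (take (suc m) u) R
... | yes _ = suc m
... | no  _ = matchLenFrom m u R

matchLen : Str → Str → ℕ
matchLen u R = matchLenFrom (length u) u R

module _ (R : Str) (SA : ℕ → ℕ) (C : Str) where

  ℓ : ℕ → ℕ
  ℓ i = matchLen (suf i C) R

  U : ℕ → Str
  U i = take (ℓ i) (suf i C)

  mis : ℕ → ℕ
  mis i = charAt C (i + ℓ i)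

  ip : ℕ → ℕ
  ip i with ℓ i
  ... | zero  = 1
  ... | suc _ with last (filter (λ k → prefix? _≟_ (U i) (suf (SA k) R)
                                    ×-dec (suf (SA k) R <ˡ? (U i ++ [ mis i ])))
                                (ranks (length R)))
  ...   | just k  = k
  ...   | nothing = fromMaybe 1 (head (filter (λ k → prefix? _≟_ (U i) (suf (SA k) R))
                                              (ranks (length R))))

  NotInsertHead : ℕ → Set
  NotInsertHead j = 2 ≤ j × SA (ip j) ≡ SA (ip (j ∸ 1)) + 1

-- The collection: a list of (string, end-of-string character) pairs;
-- C is the concatenation of the strings, each followed by its terminator.
concatColl : List (Str × ℕ) → Str
concatColl = concatMap (λ p → proj₁ p ++ [ proj₂ p ])

record Setting (IsEOS : ℕ → Set) (R : Str) (coll : List (Str × ℕ)) : Set where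
  field
    body          : Str
    R-shape       : R ≡ body ++ [ sentinel ]
    body-no-#     : All (λ x → x ≢ sentinel) body
    eos-not-#     : ∀ x → IsEOS x → x ≢ sentinel
    eos-not-in-R  : ∀ x → IsEOS x → ¬ (x ∈ R)
    terminators   : All (λ p → IsEOS (proj₂ p)) coll
    strings-plain : All (λ p → All (λ x → x ≢ sentinel × ¬ IsEOS x) (proj₁ p)) coll
    chars-in-R    : ∀ x → x ∈ concatColl coll → ¬ IsEOS x → x ∈ R

-- If j is not an insert-head then SA[ip(j)] = SA[ip(j-1)] + 1, so the character
-- R[SA[ip(j)] - 1] is the first character of the suffix of R at rank ip(j-1).
-- That rank cannot be 1 (the sentinel suffix, which has no successor position),
-- so the matching factor U_{j-1} is non-empty, and the suffix at rank ip(j-1)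
-- begins with U_{j-1}, hence with C[j-1]. Thus C[i-1] and C[j-1] both equal
-- R[SA[ip(i)] - 1] when ip(i) = ip(j).
module Submission where

open import Defs
open import Data.Nat using (ℕ; zero; suc; _+_; _∸_; _≤_; _≟_; z≤n; s≤s)
open import Data.Nat.Properties using (<-cmp; <-irrefl; n<1+n; ≤-refl; ≤-trans; <⇒≤; m+1+n≰m; m+n∸n≡m; suc-injective)
open import Data.List using (List; []; _∷_; _++_; [_]; take; length; filter; head; last)
open import Data.List.Properties using (length-++-sucʳ)
open import Data.List.Membership.Propositional using (_∈_)
open import Data.List.Membership.Propositional.Properties using (∈-map⁺; ∈-map⁻; ∈-upTo⁺; ∈-upTo⁻; ∈-filter⁺; ∈-filter⁻)
open import Data.List.Relation.Unary.Any using (here; there)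
open import Data.List.Relation.Binary.Infix.Heterogeneous using (here; there)
open import Data.List.Relation.Binary.Infix.Heterogeneous.Properties using (infix?)
open import Data.List.Relation.Binary.Prefix.Heterogeneous using (_∷_)
open import Data.List.Relation.Binary.Prefix.Heterogeneous.Properties using (prefix?)
open import Data.List.Relation.Binary.Lex.Strict using (this; next; base; <-irreflexive)
open import Data.List.Relation.Binary.Pointwise.Properties as Pointwise using ()
open import Data.Fin using (Fin; toℕ; fromℕ<)
open import Data.Fin.Properties using (toℕ-fromℕ<; toℕ-injective; toℕ<n; pigeonhole; punchOut-injective; any?)
  renaming (_≟_ to _≟ᶠ_; <-irrefl to <ᶠ-irrefl)
open import Data.Fin.Base using (punchOut)
open import Data.Maybe using (just; nothing; fromMaybe)
open import Data.Product using (_×_; _,_; proj₁; proj₂; ∃; ∃₂)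
open import Data.Empty using (⊥-elim)
open import Function using (_∘_)
open import Function.Definitions using (Injective)
open import Relation.Binary.Definitions using (tri<; tri≈; tri>)
open import Relation.Nullary using (¬_; yes; no)
open import Relation.Nullary.Decidable using (_×-dec_)
open import Relation.Binary.PropositionalEquality
  using (_≡_; refl; sym; trans; cong; cong₂; subst; subst₂; module ≡-Reasoning)

InRange : ℕ → ℕ → Set
InRange n k = 1 ≤ k × k ≤ n

∈-ranks⁺ : ∀ {n k} → InRange n k → k ∈ ranks n
∈-ranks⁺ {k = suc k} (_ , k<n) = ∈-map⁺ suc (∈-upTo⁺ k<n)

∈-ranks⁻ : ∀ {n k} → k ∈ ranks n → InRange n k
∈-ranks⁻ k∈ with _ , k<n , refl ← ∈-map⁻ suc k∈ = s≤s z≤n , ∈-upTo⁻ k<n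

module _ {A : Set} where

  head≡just⇒∈ : ∀ {xs : List A} {x} → head xs ≡ just x → x ∈ xs
  head≡just⇒∈ {_ ∷ _} refl = here refl

  head≡nothing⇒∉ : ∀ {xs : List A} {x} → head xs ≡ nothing → ¬ x ∈ xs
  head≡nothing⇒∉ {_ ∷ _} ()

  last≡just⇒∈ : ∀ {xs : List A} {x} → last xs ≡ just x → x ∈ xs
  last≡just⇒∈ {_ ∷ []}     refl = here refl
  last≡just⇒∈ {_ ∷ _ ∷ _} eq   = there (last≡just⇒∈ eq)

suf-∷ : ∀ (T : Str) {p} → InRange (length T) p → ∃₂ λ x xs → suf p T ≡ x ∷ xs
suf-∷ (x ∷ xs) {suc zero}    _               = x , xs , refl
suf-∷ (_ ∷ xs) {suc (suc p)} (_ , s≤s p<|xs|) = suf-∷ xs (s≤s z≤n , p<|xs|)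

suf-length-∷ʳ : ∀ (xs : Str) x → suf (length (xs ++ [ x ])) (xs ++ [ x ]) ≡ [ x ]
suf-length-∷ʳ []           x = refl
suf-length-∷ʳ (_ ∷ [])     x = refl
suf-length-∷ʳ (_ ∷ y ∷ xs) x = suf-length-∷ʳ (y ∷ xs) x

OccursIn⇒IsPrefix-suf : ∀ {x u} (T : Str) → OccursIn (x ∷ u) T →
                        ∃ λ p → InRange (length T) p × IsPrefix (x ∷ u) (suf p T)
OccursIn⇒IsPrefix-suf (_ ∷ _) (here pfx) = 1 , (s≤s z≤n , s≤s z≤n) , pfx
OccursIn⇒IsPrefix-suf (_ ∷ ys) (there occ)
  with suc p , (_ , p<|ys|) , pfx ← OccursIn⇒IsPrefix-suf ys occ
  = suc (suc p) , (s≤s z≤n , s≤s p<|ys|) , pfx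

head-take-suc-prefix : ∀ l {x} {xs ys : Str} → IsPrefix (take (suc l) (x ∷ xs)) ys → head ys ≡ just x
head-take-suc-prefix l (refl ∷ _) = refl

matchLenFrom≡suc⇒OccursIn : ∀ {l} m (u R : Str) → matchLenFrom m u R ≡ suc l → OccursIn (take (suc l) u) R
matchLenFrom≡suc⇒OccursIn (suc m) u R eq with infix? _≟_ (take (suc m) u) R
... | yes occ = subst (λ t → OccursIn (take t u) R) eq occ
... | no  _   = matchLenFrom≡suc⇒OccursIn m u R eq

<ˡ-irrefl : ∀ (u : Str) → ¬ u <ˡ u
<ˡ-irrefl u = <-irreflexive <-irrefl (Pointwise.refl refl)

∷≮ˡ[sentinel] : ∀ {x} {xs : Str} → ¬ (x ∷ xs) <ˡ [ sentinel ]
∷≮ˡ[sentinel] (this ())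
∷≮ˡ[sentinel] (next _ (base ()))

injective⇒surjective : ∀ {n} (f : Fin n → Fin n) → Injective _≡_ _≡_ f → ∀ y → ∃ λ x → f x ≡ y
injective⇒surjective {suc n} f f-inj y with any? (λ x → f x ≟ᶠ y)
... | yes hit = hit
... | no miss
  with i , j , i<j , eq ← pigeonhole (n<1+n n) (λ x → punchOut (miss ∘ (x ,_) ∘ sym))
  = ⊥-elim (<ᶠ-irrefl (f-inj (punchOut-injective (miss ∘ (i ,_) ∘ sym) (miss ∘ (j ,_) ∘ sym) eq)) i<j)

module _ {n : ℕ} where

  toFin : ∀ {k} → InRange n k → Fin n
  toFin {suc k} (_ , k<n) = fromℕ< k<n

  suc-toℕ-toFin : ∀ {k} (k∈ : InRange n k) → suc (toℕ (toFin k∈)) ≡ k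
  suc-toℕ-toFin {suc k} (_ , k<n) = cong suc (toℕ-fromℕ< k<n)

  fromFin-inRange : (x : Fin n) → InRange n (suc (toℕ x))
  fromFin-inRange x = s≤s z≤n , toℕ<n x

  module _ (f : ℕ → ℕ) (f-into : ∀ {k} → InRange n k → InRange n (f k))
           (f-inj : ∀ {k k'} → InRange n k → InRange n k' → f k ≡ f k' → k ≡ k') where

    private
      f̂-into : (x : Fin n) → InRange n (f (suc (toℕ x)))
      f̂-into x = f-into (fromFin-inRange x)

      f̂ : Fin n → Fin n
      f̂ x = toFin (f̂-into x)

      f-suc-toℕ : ∀ x → suc (toℕ (f̂ x)) ≡ f (suc (toℕ x))
      f-suc-toℕ x = suc-toℕ-toFin (f̂-into x)

      f̂-inj : Injective _≡_ _≡_ f̂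
      f̂-inj {x} {y} eq = toℕ-injective (suc-injective (f-inj (fromFin-inRange x) (fromFin-inRange y)
        (trans (sym (f-suc-toℕ x)) (trans (cong (suc ∘ toℕ) eq) (f-suc-toℕ y)))))

    injective-on⇒surjective-on : ∀ {p} → InRange n p → ∃ λ k → InRange n k × f k ≡ p
    injective-on⇒surjective-on p∈ with x , f̂x≡ ← injective⇒surjective f̂ f̂-inj (toFin p∈) =
      suc (toℕ x) , fromFin-inRange x ,
      trans (sym (f-suc-toℕ x)) (trans (cong (suc ∘ toℕ) f̂x≡) (suc-toℕ-toFin p∈))

module SuffixArray (R : Str) (SA : ℕ → ℕ) (isSA : IsSuffixArray R SA) where

  SA-inRange : ∀ {k} → InRange (length R) k → InRange (length R) (SA k)
  SA-inRange (1≤k , k≤n) = proj₁ isSA _ 1≤k k≤n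

  SA-injective : ∀ {k k'} → InRange (length R) k → InRange (length R) k' → SA k ≡ SA k' → k ≡ k'
  SA-injective {k} {k'} (1≤k , k≤n) (1≤k' , k'≤n) eq with <-cmp k k'
  ... | tri< k<k' _ _ = ⊥-elim (<ˡ-irrefl _ (subst (λ p → suf p R <ˡ suf (SA k') R) eq (proj₂ isSA k k' 1≤k k<k' k'≤n)))
  ... | tri≈ _ k≡k' _ = k≡k'
  ... | tri> _ _ k'<k = ⊥-elim (<ˡ-irrefl _ (subst (λ p → suf (SA k') R <ˡ suf p R) eq (proj₂ isSA k' k 1≤k' k'<k k≤n)))

  SA-surjective : ∀ {p} → InRange (length R) p → ∃ λ k → InRange (length R) k × SA k ≡ p
  SA-surjective = injective-on⇒surjective-on SA SA-inRange SA-injective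

  module Sentinel {body : Str} (R-shape : R ≡ body ++ [ sentinel ]) where

    length-R-inRange : InRange (length R) (length R)
    length-R-inRange rewrite R-shape | length-++-sucʳ body sentinel [] = s≤s z≤n , ≤-refl

    suf-length-R : suf (length R) R ≡ [ sentinel ]
    suf-length-R rewrite R-shape = suf-length-∷ʳ body sentinel

    -- the suffix [ sentinel ] is lexicographically below every other suffix
    SA-first : SA 1 ≡ length R
    SA-first with SA-surjective length-R-inRange
    ... | suc zero , _ , SA1≡n = SA1≡n
    ... | suc (suc k) , (_ , k<n) , SAk≡n
      with x , xs , suf≡ ← suf-∷ R (SA-inRange (s≤s z≤n , ≤-trans (s≤s z≤n) k<n)) =
      ⊥-elim (∷≮ˡ[sentinel] (subst₂ _<ˡ_ suf≡ (trans (cong (λ p → suf p R) SAk≡n) suf-length-R)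
                                         (proj₂ isSA 1 (suc (suc k)) (s≤s z≤n) (s≤s (s≤s z≤n)) k<n)))

module InsertPoint (R : Str) (SA : ℕ → ℕ) (C : Str) where

  data IpView (i v : ℕ) : Set where
    empty-factor : ℓ R SA C i ≡ 0 → v ≡ 1 → IpView i v
    prefixed     : ∀ {l} → ℓ R SA C i ≡ suc l → v ∈ ranks (length R) →
                   IsPrefix (U R SA C i) (suf (SA v) R) → IpView i v
    unprefixed   : ∀ {l} → ℓ R SA C i ≡ suc l → v ≡ 1 →
                   (∀ k → k ∈ ranks (length R) → ¬ IsPrefix (U R SA C i) (suf (SA k) R)) → IpView i v

  ip-view : ∀ i → IpView i (ip R SA C i)
  ip-view i with ℓ R SA C i in ℓ≡
  ... | zero = empty-factor ℓ≡ refl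
  ... | suc l with last (filter (λ k → prefix? _≟_ (U R SA C i) (suf (SA k) R)
                                    ×-dec (suf (SA k) R <ˡ? (U R SA C i ++ [ mis R SA C i ])))
                                (ranks (length R))) in last≡
  ...   | just k
    with k∈ , pfx , _ ← ∈-filter⁻ (λ k → prefix? _≟_ (U R SA C i) (suf (SA k) R)
                                          ×-dec (suf (SA k) R <ˡ? (U R SA C i ++ [ mis R SA C i ])))
                                   (last≡just⇒∈ last≡)
    = prefixed ℓ≡ k∈ pfx
  ...   | nothing with head (filter (λ k → prefix? _≟_ (U R SA C i) (suf (SA k) R)) (ranks (length R))) in head≡
  ...     | just k
    with k∈ , pfx ← ∈-filter⁻ (λ k → prefix? _≟_ (U R SA C i) (suf (SA k) R)) (head≡just⇒∈ head≡)
    = prefixed ℓ≡ k∈ pfx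
  ...     | nothing = unprefixed ℓ≡ refl λ k k∈ pfx → head≡nothing⇒∉ head≡ (∈-filter⁺ _ k∈ pfx)

module PrecedingCharacter (R : Str) (SA : ℕ → ℕ) (C : Str) {body : Str}
                          (R-shape : R ≡ body ++ [ sentinel ]) (isSA : IsSuffixArray R SA) where

  open SuffixArray R SA isSA
  open Sentinel R-shape
  open InsertPoint R SA C

  ip-inRange : ∀ i → InRange (length R) (ip R SA C i)
  ip-inRange i with ip-view i
  ... | empty-factor _ ip≡1 = subst (InRange (length R)) (sym ip≡1) (s≤s z≤n , proj₁ length-R-inRange)
  ... | prefixed _ ip∈ _    = ∈-ranks⁻ ip∈
  ... | unprefixed _ ip≡1 _ = subst (InRange (length R)) (sym ip≡1) (s≤s z≤n , proj₁ length-R-inRange)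

  U-occurs : ∀ i {l} → ℓ R SA C i ≡ suc l → OccursIn (U R SA C i) R
  U-occurs i ℓ≡ = subst (λ t → OccursIn (take t (suf i C)) R) (sym ℓ≡)
                        (matchLenFrom≡suc⇒OccursIn (length (suf i C)) (suf i C) R ℓ≡)

  U-starts-some-suffix : ∀ i {l x u} → ℓ R SA C i ≡ suc l → U R SA C i ≡ x ∷ u →
                         ∃ λ k → k ∈ ranks (length R) × IsPrefix (U R SA C i) (suf (SA k) R)
  U-starts-some-suffix i ℓ≡ U≡
    with p , p∈ , pfx ← OccursIn⇒IsPrefix-suf R (subst (λ u → OccursIn u R) U≡ (U-occurs i ℓ≡))
    with k , k∈ , SAk≡p ← SA-surjective p∈
    = k , ∈-ranks⁺ k∈ , subst₂ IsPrefix (sym U≡) (cong (λ q → suf q R) (sym SAk≡p)) pfx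

  -- rank 1 is excluded by room, since SA[1] = |R|; so U_m is non-empty and starts with C[m]
  char-at-ip : ∀ {m} → InRange (length C) m → SA (ip R SA C m) + 1 ≤ length R →
               charAt C m ≡ charAt R (SA (ip R SA C m))
  char-at-ip {m} m∈ room with x , xs , suf≡ ← suf-∷ C m∈ with ip-view m
  ... | empty-factor _ ip≡1 =
    ⊥-elim (m+1+n≰m (length R) (subst (λ p → p + 1 ≤ length R) (trans (cong SA ip≡1) SA-first) room))
  ... | prefixed {l} ℓ≡ _ pfx = begin
    charAt C m                   ≡⟨ cong (fromMaybe 0 ∘ head) suf≡ ⟩
    x                            ≡⟨ cong (fromMaybe 0) (head-take-suc-prefix l pfx′) ⟨
    charAt R (SA (ip R SA C m))  ∎
    where
      open ≡-Reasoning
      pfx′ : IsPrefix (take (suc l) (x ∷ xs)) (suf (SA (ip R SA C m)) R)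
      pfx′ = subst (λ u → IsPrefix u (suf (SA (ip R SA C m)) R)) (cong₂ take ℓ≡ suf≡) pfx
  ... | unprefixed ℓ≡ _ none
    with k , k∈ , pfx ← U-starts-some-suffix m ℓ≡ (cong₂ take ℓ≡ suf≡)
    = ⊥-elim (none k k∈ pfx)

  preceding-char : ∀ {j} → j ≤ length C → NotInsertHead R SA C j →
                   charAt C (j ∸ 1) ≡ charAt R (SA (ip R SA C j) ∸ 1)
  preceding-char {suc zero}    _  (s≤s () , _)
  preceding-char {suc (suc m)} j≤ (_ , SA-step) = begin
    charAt C (suc m)                          ≡⟨ char-at-ip (s≤s z≤n , <⇒≤ j≤) room ⟩
    charAt R (SA (ip R SA C (suc m)))         ≡⟨ cong (charAt R) (m+n∸n≡m (SA (ip R SA C (suc m))) 1) ⟨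
    charAt R (SA (ip R SA C (suc m)) + 1 ∸ 1) ≡⟨ cong (λ p → charAt R (p ∸ 1)) SA-step ⟨
    charAt R (SA (ip R SA C (suc (suc m))) ∸ 1) ∎
    where
      open ≡-Reasoning
      room : SA (ip R SA C (suc m)) + 1 ≤ length R
      room = subst (_≤ length R) SA-step (proj₂ (SA-inRange (ip-inRange (suc (suc m)))))

lemma5 : (IsEOS : ℕ → Set) (R : Str) (coll : List (Str × ℕ)) (SA : ℕ → ℕ) →
         Setting IsEOS R coll → IsSuffixArray R SA →
         (i j : ℕ) → 1 ≤ i → i ≤ length (concatColl coll) →
         1 ≤ j → j ≤ length (concatColl coll) →
         ip R SA (concatColl coll) i ≡ ip R SA (concatColl coll) j →
         NotInsertHead R SA (concatColl coll) i →
         NotInsertHead R SA (concatColl coll) j →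
         (charAt (concatColl coll) (i ∸ 1) ≡ charAt (concatColl coll) (j ∸ 1)) ×
         (charAt (concatColl coll) (i ∸ 1) ≡ charAt R (SA (ip R SA (concatColl coll) i) ∸ 1))
lemma5 IsEOS R coll SA setting isSA i j _ i≤ _ j≤ same-ip i-not-head j-not-head =
  (begin
    charAt C (i ∸ 1)                ≡⟨ preceding-i ⟩
    charAt R (SA (ip R SA C i) ∸ 1) ≡⟨ cong (λ k → charAt R (SA k ∸ 1)) same-ip ⟩
    charAt R (SA (ip R SA C j) ∸ 1) ≡⟨ preceding-char j≤ j-not-head ⟨
    charAt C (j ∸ 1)                ∎) ,
  preceding-i
  where
    open ≡-Reasoning
    C : Str
    C = concatColl coll
    open PrecedingCharacter R SA C (Setting.R-shape setting) isSA
    preceding-i : charAt C (i ∸ 1) ≡ charAt R (SA (ip R SA C i) ∸ 1)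
    preceding-i = preceding-char i≤ i-not-head
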